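{- Let $\pi\in S_n$ and $1\le i\le n$. If the degree of $i$ in $G_\pi$ is $k$, then $|\pi^{ -1}(i)-i|\le k$ and $\pi^{ -1}(i)-i\equiv k\pmod 2$. In particular, if $i$ is a leaf of $G_\pi$ (degree $1$), then $\pi^{ -1}(i)\in\{i-1,i+1\}$.
   Context: For a permutation $\pi$ of $[n]=\{1,\dots,n\}$ (one-line notation $[\pi(1),\dots,\pi(n)]$), the permutation graph $G_\pi$ has vertex set $[n]$ and an edge between $i<j$ iff $\pi^{ -1}(i)>\pi^{ -1}(j)$. -}

module Defs where

open import Data.Nat using (ℕ)
open import Data.Fin using (Fin; toℕ; _<_; _<?_)
open import Data.Fin.Permutation using (Permutation′; _⟨$⟩ʳ_; _⟨$⟩ˡ_)
open import Data.List using (length; filter)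
open import Data.List.Base using (allFin)
open import Data.Sum using (_⊎_)
open import Data.Product using (_×_)
open import Relation.Nullary.Decidable using (_×-dec_; _⊎-dec_)
open import Relation.Binary using (Rel; Decidable)

-- A permutation π of [n] is encoded with 0-indexed vertices Fin n
-- (vertex i here stands for i+1 in the paper); π ⟨$⟩ʳ p = π(p),
-- π ⟨$⟩ˡ v = π⁻¹(v) (the position of value v in one-line notation).

pos : ∀ {n} → Permutation′ n → Fin n → Fin n
pos π v = π ⟨$⟩ˡ v

Edge : ∀ {n} → Permutation′ n → Rel (Fin n) _
Edge π i j = (i < j × pos π j < pos π i) ⊎ (j < i × pos π i < pos π j)

edge? : ∀ {n} (π : Permutation′ n) → Decidable (Edge π)
edge? π i j = ((i <? j) ×-dec (pos π j <? pos π i)) ⊎-dec ((j <? i) ×-dec (pos π i <? pos π j))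

degree : ∀ {n} → Permutation′ n → Fin n → ℕ
degree {n} π i = length (filter (edge? π i) (allFin n))

module Submission where

-- Let p = π⁻¹(i) be the position of the value i and sort
-- every value j by the two comparisons "j < i" and "π⁻¹(j) < p":
--   Smaller = { j < i  with π⁻¹(j) > p }   (neighbours of i below i),
--   Larger  = { j > i  with π⁻¹(j) < p }   (neighbours of i above i),
--   Before  = { j < i  with π⁻¹(j) < p }.
-- The values below i split into Before and Smaller, so i = C + A; the
-- values at positions before p split into Before and Larger, so p = C + B;
-- and the neighbours of i in G_π are exactly Larger ∪ Smaller, so
-- deg(i) = B + A (A, B, C the sizes of Smaller, Larger, Before).  Hence
-- p - i = B - A, and the three claims become facts about naturals:
-- |B - A| ≤ B + A, (B - A) - (B + A) = -2A is even, and B + A = 1 forces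
-- B - A = ±1.

open import Defs
open import Data.Nat using (ℕ)
open import Data.Fin using (Fin; toℕ)
open import Data.Fin.Permutation using (Permutation′)
open import Data.Integer using (+_; _+_; _-_; ∣_∣)
open import Data.Integer.Divisibility using (_∣_)
open import Data.Nat as N using ()
open import Data.Product using (_×_)
open import Data.Sum using (_⊎_)
open import Relation.Binary.PropositionalEquality using (_≡_)

open import Data.Bool using (if_then_else_)
open import Data.Empty using (⊥-elim)
open import Data.Product using (_,_; proj₁; proj₂)
open import Data.Sum using (inj₁; inj₂; [_,_])
open import Data.List using (length; filter; tabulate)
import Data.Fin as F
import Data.Fin.Properties as FP
import Data.Fin.Permutation as Perm
open import Data.Fin.Permutation using (_⟨$⟩ʳ_)
import Data.Nat.Properties as NP
import Data.Nat.Divisibility as ND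
import Data.Integer as Z
import Data.Integer.Properties as ZP
open import Data.Integer.Tactic.RingSolver using (solve-∀)
open import Algebra.Properties.CommutativeMonoid.Sum NP.+-0-commutativeMonoid
  using (sum; sum-cong-≗; sum-permute; ∑-distrib-+; sum-replicate-zero)
open import Relation.Binary.Definitions using (tri<; tri≈; tri>)
open import Relation.Binary.PropositionalEquality using (_≢_; refl; sym; trans; cong; subst; module ≡-Reasoning)
open import Relation.Nullary using (Dec; yes; no; does; ¬_)
open import Relation.Nullary.Decidable using (_×-dec_)
open import Relation.Unary using (Pred; Decidable)

-- The 0/1 indicator of a decided proposition.  It only inspects the
-- boolean `does d`, so deciders that compute the same boolean have the same
-- indicator definitionally.
indicator : ∀ {p} {P : Set p} → Dec P → ℕ
indicator d = if does d then 1 else 0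

indicator-⊎ : ∀ {p q r} {P : Set p} {Q : Set q} {R : Set r} →
  (R → P ⊎ Q) → (P ⊎ Q → R) → (P → ¬ Q) →
  (R? : Dec R) (P? : Dec P) (Q? : Dec Q) →
  indicator R? ≡ indicator P? N.+ indicator Q?
indicator-⊎ to from disjoint (yes _) (yes p) (yes q) = ⊥-elim (disjoint p q)
indicator-⊎ to from disjoint (yes _) (yes _) (no _) = refl
indicator-⊎ to from disjoint (yes _) (no _) (yes _) = refl
indicator-⊎ to from disjoint (yes r) (no ¬p) (no ¬q) = ⊥-elim ([ ¬p , ¬q ] (to r))
indicator-⊎ to from disjoint (no ¬r) (yes p) _ = ⊥-elim (¬r (from (inj₁ p)))
indicator-⊎ to from disjoint (no ¬r) (no _) (yes q) = ⊥-elim (¬r (from (inj₂ q)))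
indicator-⊎ to from disjoint (no _) (no _) (no _) = refl

count : ∀ {n p} {P : Pred (Fin n) p} → Decidable P → ℕ
count P? = sum (λ j → indicator (P? j))

length-filter-tabulate : ∀ {a p} {A : Set a} {P : Pred A p} (P? : Decidable P)
  {n} (f : Fin n → A) → length (filter P? (tabulate f)) ≡ count (λ j → P? (f j))
length-filter-tabulate P? {ℕ.zero} f = refl
length-filter-tabulate P? {ℕ.suc n} f with P? (f F.zero)
... | yes _ = cong ℕ.suc (length-filter-tabulate P? (λ j → f (F.suc j)))
... | no _ = length-filter-tabulate P? (λ j → f (F.suc j))

count-⊎ : ∀ {n p q r} {P : Pred (Fin n) p} {Q : Pred (Fin n) q} {R : Pred (Fin n) r}
  (R? : Decidable R) (P? : Decidable P) (Q? : Decidable Q) →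
  (∀ j → R j → P j ⊎ Q j) → (∀ j → P j ⊎ Q j → R j) → (∀ j → P j → ¬ Q j) →
  count R? ≡ count P? N.+ count Q?
count-⊎ R? P? Q? to from disjoint =
  trans (sum-cong-≗ (λ j → indicator-⊎ (to j) (from j) (disjoint j) (R? j) (P? j) (Q? j)))
        (∑-distrib-+ (λ j → indicator (P? j)) (λ j → indicator (Q? j)))

count-permute : ∀ {n p} {P : Pred (Fin n) p} (P? : Decidable P) (σ : Permutation′ n) →
  count P? ≡ count (λ j → P? (σ ⟨$⟩ʳ j))
count-permute P? σ = sum-permute (λ j → indicator (P? j)) σ

-- Exactly toℕ p elements of Fin n lie below p.  By induction on p: the
-- indicator of 0 < suc p is 1 and that of suc q < suc p computes as q < p.
count-below : ∀ {n} (p : Fin n) → count (λ (q : Fin n) → q F.<? p) ≡ toℕ p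
count-below {ℕ.suc n} F.zero = sum-replicate-zero (ℕ.suc n)
count-below {ℕ.suc n} (F.suc p) = cong ℕ.suc (count-below p)

difference-shift : ∀ a b c → (c Z.+ b) - (c Z.+ a) ≡ b - a
difference-shift = solve-∀

∣difference∣≤sum : ∀ A B → ∣ + B - + A ∣ N.≤ B N.+ A
∣difference∣≤sum A B =
  subst (λ x → ∣ + B - + A ∣ N.≤ B N.+ x) (ZP.∣-i∣≡∣i∣ (+ A)) (ZP.∣i+j∣≤∣i∣+∣j∣ (+ B) (Z.- + A))

difference-sum-even : ∀ A B → (+ 2) ∣ ((+ B - + A) - + (B N.+ A))
difference-sum-even A B = ND.divides A (begin
  ∣ (+ B - + A) - (+ B Z.+ + A) ∣  ≡⟨ cong ∣_∣ (twice-negated (+ A) (+ B)) ⟩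
  ∣ (Z.- + A) Z.* + 2 ∣            ≡⟨ ZP.abs-* (Z.- + A) (+ 2) ⟩
  ∣ Z.- + A ∣ N.* 2                ≡⟨ cong (N._* 2) (ZP.∣-i∣≡∣i∣ (+ A)) ⟩
  A N.* 2                          ∎)
  where
  open ≡-Reasoning
  twice-negated : ∀ a b → (b - a) - (b Z.+ a) ≡ (Z.- a) Z.* + 2
  twice-negated = solve-∀

unit-sum-neighbour : ∀ A B C → B N.+ A ≡ 1 →
  (+ (C N.+ B) ≡ + (C N.+ A) - + 1) ⊎ (+ (C N.+ B) ≡ + (C N.+ A) + + 1)
unit-sum-neighbour 1 0 C refl rewrite NP.+-identityʳ C = inj₁ (add-sub (+ C))
  where
  add-sub : ∀ c → c ≡ (c Z.+ + 1) - + 1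
  add-sub = solve-∀
unit-sum-neighbour 0 1 C refl rewrite NP.+-identityʳ C = inj₂ refl
unit-sum-neighbour 0 0 C ()
unit-sum-neighbour (ℕ.suc (ℕ.suc A)) 0 C ()
unit-sum-neighbour A (ℕ.suc (ℕ.suc B)) C ()
unit-sum-neighbour (ℕ.suc A) 1 C ()

displacement : ∀ A B C {P I k} → P ≡ C N.+ B → I ≡ C N.+ A → k ≡ B N.+ A →
    (∣ + P - + I ∣ N.≤ k)
    × ((+ 2) ∣ ((+ P - + I) - + k))
    × (k ≡ 1 → (+ P ≡ + I - + 1) ⊎ (+ P ≡ + I + + 1))
displacement A B C refl refl refl rewrite difference-shift (+ A) (+ B) (+ C) =
  ∣difference∣≤sum A B , difference-sum-even A B , unit-sum-neighbour A B C

≢⇒<⊎> : ∀ {n} {x y : Fin n} → x ≢ y → x F.< y ⊎ y F.< x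
≢⇒<⊎> {x = x} {y} x≢y with FP.<-cmp x y
... | tri< x<y _ _ = inj₁ x<y
... | tri≈ _ x≡y _ = ⊥-elim (x≢y x≡y)
... | tri> _ _ y<x = inj₂ y<x

pos-injective : ∀ {n} (π : Permutation′ n) {i j} → pos π j ≡ pos π i → j ≡ i
pos-injective π {i} {j} eq =
  trans (sym (Perm.inverseʳ π)) (trans (cong (π ⟨$⟩ʳ_) eq) (Perm.inverseʳ π))

module Neighbourhood {n} (π : Permutation′ n) (i : Fin n) where
  open ≡-Reasoning

  p : Fin n
  p = pos π i

  Smaller Larger Before : Pred (Fin n) _
  Smaller j = j F.< i × p F.< pos π j
  Larger j = i F.< j × pos π j F.< p
  Before j = j F.< i × pos π j F.< p

  smaller? : Decidable Smaller
  smaller? j = (j F.<? i) ×-dec (p F.<? pos π j)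
  larger? : Decidable Larger
  larger? j = (i F.<? j) ×-dec (pos π j F.<? p)
  before? : Decidable Before
  before? j = (j F.<? i) ×-dec (pos π j F.<? p)

  -- A value below i is Before or Smaller, since it sits at a position ≠ p.
  below-split : ∀ j → j F.< i → Before j ⊎ Smaller j
  below-split j j<i with ≢⇒<⊎> (λ eq → FP.<-irrefl (pos-injective π eq) j<i)
  ... | inj₁ before = inj₁ (j<i , before)
  ... | inj₂ after = inj₂ (j<i , after)

  -- A value at a position before p is Before or Larger, since it is ≠ i.
  before-split : ∀ j → pos π j F.< p → Before j ⊎ Larger j
  before-split j j<p with ≢⇒<⊎> (λ (eq : j ≡ i) → FP.<-irrefl (cong (pos π) eq) j<p)
  ... | inj₁ below = inj₁ (below , j<p)
  ... | inj₂ above = inj₂ (above , j<p)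

  values-below : toℕ i ≡ count before? N.+ count smaller?
  values-below = begin
    toℕ i                             ≡⟨ count-below i ⟨
    count (λ (j : Fin n) → j F.<? i)  ≡⟨ count-⊎ (λ (j : Fin n) → j F.<? i) before? smaller?
                                           below-split (λ j → [ proj₁ , proj₁ ])
                                           (λ j b s → FP.<-asym (proj₂ b) (proj₂ s)) ⟩
    count before? N.+ count smaller?  ∎

  -- p = C + B: reindexing by π, the positions before p carry exactly the
  -- values of Before ∪ Larger.
  positions-before : toℕ p ≡ count before? N.+ count larger?
  positions-before = begin
    toℕ p                             ≡⟨ count-below p ⟨
    count (λ (q : Fin n) → q F.<? p)  ≡⟨ count-permute (λ q → q F.<? p) (Perm.flip π) ⟩
    count (λ j → pos π j F.<? p)      ≡⟨ count-⊎ (λ j → pos π j F.<? p) before? larger?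
                                           before-split (λ j → [ proj₂ , proj₂ ])
                                           (λ j b l → FP.<-asym (proj₁ b) (proj₁ l)) ⟩
    count before? N.+ count larger?   ∎

  neighbours : degree π i ≡ count larger? N.+ count smaller?
  neighbours = begin
    degree π i                        ≡⟨ length-filter-tabulate (edge? π i) (λ j → j) ⟩
    count (edge? π i)                 ≡⟨ count-⊎ (edge? π i) larger? smaller? (λ j e → e) (λ j e → e)
                                           (λ j l s → FP.<-asym (proj₁ l) (proj₁ s)) ⟩
    count larger? N.+ count smaller?  ∎

lemma7 : ∀ {n} (π : Permutation′ n) (i : Fin n) (k : ℕ) → degree π i ≡ k →
    (∣ + toℕ (pos π i) - + toℕ i ∣ N.≤ k)
    × ((+ 2) ∣ ((+ toℕ (pos π i) - + toℕ i) - + k))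
    × (k ≡ 1 → (+ toℕ (pos π i) ≡ + toℕ i - + 1) ⊎ (+ toℕ (pos π i) ≡ + toℕ i + + 1))
lemma7 π i k deg =
  displacement (count smaller?) (count larger?) (count before?)
    positions-before values-below (trans (sym deg) neighbours)
  where open Neighbourhood π i
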